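{- Every frame matroid is quasi-graphic.
   Context: For a graph $G$ and a vertex $v$, $\mathrm{loops}_G(v)$ denotes the set of loop-edges of $G$ at $v$. Graphs are finite and may have loops and parallel edges. For a set $X$ of edges, $G[X]$ is the subgraph of $G$ with edge-set $X$ and no isolated vertices. A graph $G$ is a framework for a matroid $M$ if (1) $E(G)=E(M)$; (2) $r_M(E(H))\le |V(H)|$ for each component $H$ of $G$; (3) for each vertex $v$ of $G$, $\mathrm{cl}_M(E(G-v))\subseteq E(G-v)\cup \mathrm{loops}_G(v)$; and (4) for each circuit $C$ of $M$, the subgraph $G[C]$ has at most two components. A matroid is quasi-graphic if it has a framework. A framed matroid is a pair $(M,V)$ where $M$ is a matroid, $V$ is a basis of $M$, and each element of $M$ is spanned by a subset of $V$ with at most two elements. A matroid $M$ is a frame matroid if there is a framed matroid $(M',V)$ with $M=M'\setminus V$. -}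

module Defs where

open import Data.Nat using (ℕ; _+_; _≤_; _<_)
open import Data.Bool using (Bool; true; false; _∧_; _∨_; not)
open import Data.Fin using (Fin; _≟_)
open import Data.Fin.Subset
  using (Subset; _∈_; _⊆_; _⊂_; _∪_; _∩_; ⁅_⁆; ∣_∣; ⊤)
open import Data.Vec using (Vec; _++_; replicate; tabulate; lookup)
open import Data.Product using (Σ; ∃; _×_; proj₁; proj₂; _,_)
open import Data.Sum using (_⊎_)
open import Relation.Nullary.Decidable using (⌊_⌋)
open import Relation.Binary.PropositionalEquality using (_≡_)
open import Relation.Binary.Construct.Closure.ReflexiveTransitive using (Star)

record Matroid (n : ℕ) : Set where
  field
    r        : Subset n → ℕ
    r-bound  : ∀ X → r X ≤ ∣ X ∣
    r-mono   : ∀ X Y → X ⊆ Y → r X ≤ r Y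
    r-submod : ∀ X Y → r (X ∪ Y) + r (X ∩ Y) ≤ r X + r Y

open Matroid public

module _ {n : ℕ} (M : Matroid n) where

  Independent : Subset n → Set
  Independent X = r M X ≡ ∣ X ∣

  Circuit : Subset n → Set
  Circuit C = (r M C < ∣ C ∣) × (∀ Y → Y ⊂ C → Independent Y)

  Basis : Subset n → Set
  Basis B = Independent B × (r M B ≡ r M ⊤)

  InClosure : Fin n → Subset n → Set
  InClosure e X = r M (⁅ e ⁆ ∪ X) ≡ r M X

-- Graphs with edge set Fin n (loops and parallel edges allowed).
-- An edge e has ends proj₁ (ends e) and proj₂ (ends e); it is a loop iff
-- these coincide.

record Graph (n : ℕ) : Set where
  field
    nv   : ℕ
    ends : Fin n → Fin nv × Fin nv

open Graph public

module _ {n : ℕ} (G : Graph n) where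

  incident : Fin n → Fin (nv G) → Bool
  incident e v = ⌊ proj₁ (ends G e) ≟ v ⌋ ∨ ⌊ proj₂ (ends G e) ≟ v ⌋

  IsEnd : Fin (nv G) → Fin n → Set
  IsEnd v e = (proj₁ (ends G e) ≡ v) ⊎ (proj₂ (ends G e) ≡ v)

  AdjVia : Subset n → Fin (nv G) → Fin (nv G) → Set
  AdjVia X u w = ∃ λ e → e ∈ X ×
    (((proj₁ (ends G e) ≡ u) × (proj₂ (ends G e) ≡ w)) ⊎
     ((proj₁ (ends G e) ≡ w) × (proj₂ (ends G e) ≡ u)))

  ConnVia : Subset n → Fin (nv G) → Fin (nv G) → Set
  ConnVia X = Star (AdjVia X)

  IsComponent : Subset (nv G) → Set
  IsComponent K = (∃ λ v → v ∈ K)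
                × (∀ u w → u ∈ K → w ∈ K → ConnVia ⊤ u w)
                × (∀ u w → u ∈ K → ConnVia ⊤ u w → w ∈ K)

  edgesIn : Subset (nv G) → Subset n
  edgesIn K = tabulate λ e →
    lookup K (proj₁ (ends G e)) ∧ lookup K (proj₂ (ends G e))

  edgesAvoiding : Fin (nv G) → Subset n
  edgesAvoiding v = tabulate λ e → not (incident e v)

  IsLoopAt : Fin n → Fin (nv G) → Set
  IsLoopAt e v = (proj₁ (ends G e) ≡ v) × (proj₂ (ends G e) ≡ v)

  -- G[X] (edge set X, no isolated vertices) has at most two components:
  -- every vertex of G[X] is connected in G[X] to one of two vertices a, b.
  AtMostTwoComponents : Subset n → Set
  AtMostTwoComponents X = ∃ λ a → ∃ λ b →
    ∀ e x → e ∈ X → IsEnd x e → ConnVia X a x ⊎ ConnVia X b x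

record Framework {n : ℕ} (M : Matroid n) (G : Graph n) : Set where
  field
    -- (1) E(G) = E(M) holds by construction (both are Fin n)
    -- (2)
    comp-rank : ∀ K → IsComponent G K → r M (edgesIn G K) ≤ ∣ K ∣
    vertex-cl : ∀ v e → InClosure M e (edgesAvoiding G v) →
                e ∈ edgesAvoiding G v ⊎ IsLoopAt G e v
    circuit-comps : ∀ C → Circuit M C → AtMostTwoComponents G C

QuasiGraphic : {n : ℕ} → Matroid n → Set
QuasiGraphic {n} M = ∃ λ (G : Graph n) → Framework M G

frameSet : (n k : ℕ) → Subset (n + k)
frameSet n k = replicate n false ++ replicate k true

embed : {n : ℕ} (k : ℕ) → Subset n → Subset (n + k)
embed {n} k X = X ++ replicate k false

Framed : {m : ℕ} → Matroid m → Subset m → Set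
Framed M' V = Basis M' V
  × (∀ e → ∃ λ S → S ⊆ V × ∣ S ∣ ≤ 2 × InClosure M' e S)

-- M is a frame matroid: M = M' \ V for some framed matroid (M', V)
FrameMatroid : {n : ℕ} → Matroid n → Set
FrameMatroid {n} M = ∃ λ (k : ℕ) → ∃ λ (M' : Matroid (n + k)) →
  Framed M' (frameSet n k) × (∀ X → r M X ≡ r M' (embed k X))

-- Let (M', V) be a framed matroid with M = M' \ V, and take as vertices the
-- elements of M'.  Each element e of M is spanned by some {x, y} ⊆ V; make e an
-- edge xy, except that e becomes a loop at y when e is already spanned by V - x
-- (independence of V then gives e ∈ cl {y}), and a loop of M becomes a loop at
-- the vertex e itself.  So every edge is spanned by its ends in V, and every end
-- of a non-loop edge e is essential: e is not spanned by V minus that end.  The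
-- first fact bounds the rank of the edges inside any vertex set K by
-- |V ∩ K| ≤ |K|; together with the second it shows that an edge spanned by
-- E(G - v) cannot have exactly one end at v.  Finally, if a circuit C had edges
-- inside and outside a vertex set R closed under the edges of C, those two parts
-- would be spanned by the disjoint parts V ∩ R and V - R of the independent set
-- V and hence be skew; both are independent, so C itself would be.  Hence G[C]
-- is connected.
module Submission where

open import Defs
open import Data.Nat using (ℕ; suc; _+_; _≤_; _<_; z≤n; s≤s; _≤?_)
open import Data.Nat.Properties
open import Data.Nat.Solver using (module +-*-Solver)
open import Data.Bool using (true; false; _∧_; _∨_; not)
open import Data.Fin using (Fin; zero; suc; _↑ˡ_) renaming (_≟_ to _≟ᶠ_)
open import Data.Fin.Properties using (any?)
open import Data.Fin.Subset
  using (Subset; _∈_; _∉_; _⊆_; _⊂_; _⊃_; _∪_; _∩_; _-_; ⁅_⁆; ∣_∣; ∁; Nonempty)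
open import Data.Fin.Subset.Properties
  using ( _∈?_; nonempty?; Empty-unique; ∣⊥∣≡0; ∉⊥; x∈⁅x⁆; x∈⁅y⁆⇒x≡y; x≢y⇒x∉⁅y⁆
        ; ⊆-trans; ⊆-reflexive; ⊆-antisym; p⊆p∪q; q⊆p∪q; x∈p∪q⁺; x∈p∪q⁻
        ; p∩q⊆p; p∩q⊆q; x∈p∩q⁺; x∈p∩q⁻; x∈∁p⇒x∉p; x∉p⇒x∈∁p; p─q⊆p
        ; x∈p∧x≢y⇒x∈p-y; x∈p⇒p-x⊂p; x∈p⇒∣p-x∣<∣p∣; ∣p∩q∣≤∣q∣; p⊆q⇒∣p∣≤∣q∣; ∪-comm )
open import Data.Fin.Subset.Induction using (⊂-wellFounded; ⊃-wellFounded)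
open import Data.Vec using ([]; _∷_; here; there; lookup)
open import Data.Vec.Properties using (lookup∘tabulate; []=⇒lookup; lookup⇒[]=)
open import Data.Product using (∃; ∃₂; _×_; _,_; proj₁; proj₂)
open import Data.Sum using (_⊎_; inj₁; inj₂; [_,_])
import Data.Sum as Sum
open import Data.Empty using (⊥-elim)
open import Function using (id; _∘_)
open import Induction.WellFounded using (Acc; acc)
open import Relation.Nullary using (Dec; yes; no; ¬_)
open import Relation.Nullary.Decidable using (⌊_⌋; _×-dec_; _⊎-dec_; ¬?; decidable-stable)
open import Relation.Binary.PropositionalEquality hiding ([_])
open import Relation.Binary.Construct.Closure.ReflexiveTransitive using (ε; _◅_; _◅◅_)

module _ {m : ℕ} where

  ∪-lub : {p q s : Subset m} → p ⊆ s → q ⊆ s → p ∪ q ⊆ s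
  ∪-lub p⊆s q⊆s x∈p∪q = [ p⊆s , q⊆s ] (x∈p∪q⁻ _ _ x∈p∪q)

  ∪-mono : {p p′ q q′ : Subset m} → p ⊆ p′ → q ⊆ q′ → p ∪ q ⊆ p′ ∪ q′
  ∪-mono {p′ = p′} {q′ = q′} p⊆p′ q⊆q′ =
    ∪-lub (p⊆p∪q q′ ∘ p⊆p′) (q⊆p∪q p′ q′ ∘ q⊆q′)

  ∩-glb : {p q s : Subset m} → s ⊆ p → s ⊆ q → s ⊆ p ∩ q
  ∩-glb s⊆p s⊆q x∈s = x∈p∩q⁺ (s⊆p x∈s , s⊆q x∈s)

  p⊆[p∩q]∪[p∩∁q] : (p q : Subset m) → p ⊆ (p ∩ q) ∪ (p ∩ ∁ q)
  p⊆[p∩q]∪[p∩∁q] p q {x} x∈p with x ∈? q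
  ... | yes x∈q = x∈p∪q⁺ (inj₁ (x∈p∩q⁺ (x∈p , x∈q)))
  ... | no  x∉q = x∈p∪q⁺ (inj₂ (x∈p∩q⁺ (x∈p , x∉p⇒x∈∁p x∉q)))

  p⊆⁅x⁆∪p-x : (p : Subset m) (x : Fin m) → p ⊆ ⁅ x ⁆ ∪ (p - x)
  p⊆⁅x⁆∪p-x p x {i} i∈p with i ≟ᶠ x
  ... | yes refl = x∈p∪q⁺ (inj₁ (x∈⁅x⁆ x))
  ... | no  i≢x  = x∈p∪q⁺ (inj₂ (x∈p∧x≢y⇒x∈p-y i∈p i≢x))

∣p∩q∣+∣p∩∁q∣≡∣p∣ : ∀ {m} (p q : Subset m) → ∣ p ∩ q ∣ + ∣ p ∩ ∁ q ∣ ≡ ∣ p ∣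
∣p∩q∣+∣p∩∁q∣≡∣p∣ []           []           = refl
∣p∩q∣+∣p∩∁q∣≡∣p∣ (true  ∷ p) (true  ∷ q) = cong suc (∣p∩q∣+∣p∩∁q∣≡∣p∣ p q)
∣p∩q∣+∣p∩∁q∣≡∣p∣ (true  ∷ p) (false ∷ q) =
  trans (+-suc _ _) (cong suc (∣p∩q∣+∣p∩∁q∣≡∣p∣ p q))
∣p∩q∣+∣p∩∁q∣≡∣p∣ (false ∷ p) (true  ∷ q) = ∣p∩q∣+∣p∩∁q∣≡∣p∣ p q
∣p∩q∣+∣p∩∁q∣≡∣p∣ (false ∷ p) (false ∷ q) = ∣p∩q∣+∣p∩∁q∣≡∣p∣ p q

∣p∪q∣+∣p∩q∣≡∣p∣+∣q∣ : ∀ {m} (p q : Subset m) → ∣ p ∪ q ∣ + ∣ p ∩ q ∣ ≡ ∣ p ∣ + ∣ q ∣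
∣p∪q∣+∣p∩q∣≡∣p∣+∣q∣ []           []           = refl
∣p∪q∣+∣p∩q∣≡∣p∣+∣q∣ (true  ∷ p) (true  ∷ q) = cong suc (begin
  ∣ p ∪ q ∣ + suc ∣ p ∩ q ∣ ≡⟨ +-suc _ _ ⟩
  suc (∣ p ∪ q ∣ + ∣ p ∩ q ∣) ≡⟨ cong suc (∣p∪q∣+∣p∩q∣≡∣p∣+∣q∣ p q) ⟩
  suc (∣ p ∣ + ∣ q ∣) ≡⟨ +-suc _ _ ⟨
  ∣ p ∣ + suc ∣ q ∣ ∎)
  where open ≡-Reasoning
∣p∪q∣+∣p∩q∣≡∣p∣+∣q∣ (true  ∷ p) (false ∷ q) = cong suc (∣p∪q∣+∣p∩q∣≡∣p∣+∣q∣ p q)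
∣p∪q∣+∣p∩q∣≡∣p∣+∣q∣ (false ∷ p) (true  ∷ q) =
  trans (cong suc (∣p∪q∣+∣p∩q∣≡∣p∣+∣q∣ p q)) (sym (+-suc _ _))
∣p∪q∣+∣p∩q∣≡∣p∣+∣q∣ (false ∷ p) (false ∷ q) = ∣p∪q∣+∣p∩q∣≡∣p∣+∣q∣ p q

∣p∪q∣≤∣p∣+∣q∣ : ∀ {m} (p q : Subset m) → ∣ p ∪ q ∣ ≤ ∣ p ∣ + ∣ q ∣
∣p∪q∣≤∣p∣+∣q∣ p q =
  ≤-trans (m≤m+n ∣ p ∪ q ∣ ∣ p ∩ q ∣) (≤-reflexive (∣p∪q∣+∣p∩q∣≡∣p∣+∣q∣ p q))

∣p∣≤1⇒p⊆⁅x⁆ : ∀ {m} {p : Subset m} {x} → ∣ p ∣ ≤ 1 → x ∈ p → p ⊆ ⁅ x ⁆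
∣p∣≤1⇒p⊆⁅x⁆ {p = p} {x} ∣p∣≤1 x∈p i∈p with x∈p∪q⁻ _ _ (p⊆⁅x⁆∪p-x p x i∈p)
... | inj₁ i∈⁅x⁆ = i∈⁅x⁆
... | inj₂ i∈p-x = ⊥-elim (1+n≰n (≤-trans two≤∣p∣ ∣p∣≤1))
  where
  two≤∣p∣ : 2 ≤ ∣ p ∣
  two≤∣p∣ = ≤-trans (s≤s (≤-trans (s≤s z≤n) (x∈p⇒∣p-x∣<∣p∣ i∈p-x))) (x∈p⇒∣p-x∣<∣p∣ x∈p)

-- The point d only serves to cover the empty set.
∣p∣≤2⇒p⊆⁅x⁆∪⁅y⁆ : ∀ {m} (p : Subset m) → Fin m → ∣ p ∣ ≤ 2 →
                  ∃₂ λ x y → p ⊆ ⁅ x ⁆ ∪ ⁅ y ⁆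
∣p∣≤2⇒p⊆⁅x⁆∪⁅y⁆ p d ∣p∣≤2 with nonempty? p
... | no p-empty = d , d , λ i∈p → ⊥-elim (p-empty (_ , i∈p))
... | yes (x , x∈p) with nonempty? (p - x)
...   | no rest-empty = x , x , λ i∈p →
        [ p⊆p∪q ⁅ x ⁆ , (λ i∈p-x → ⊥-elim (rest-empty (_ , i∈p-x))) ]
          (x∈p∪q⁻ _ _ (p⊆⁅x⁆∪p-x p x i∈p))
...   | yes (y , y∈p-x) = x , y , λ i∈p →
        x∈p∪q⁺ (Sum.map₂ (∣p∣≤1⇒p⊆⁅x⁆ ∣p-x∣≤1 y∈p-x) (x∈p∪q⁻ _ _ (p⊆⁅x⁆∪p-x p x i∈p)))
  where
  ∣p-x∣≤1 : ∣ p - x ∣ ≤ 1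
  ∣p-x∣≤1 = ≤-pred (≤-trans (x∈p⇒∣p-x∣<∣p∣ x∈p) ∣p∣≤2)

∈-embed⁺ : ∀ {n} k {X : Subset n} {e} → e ∈ X → e ↑ˡ k ∈ embed k X
∈-embed⁺ k here        = here
∈-embed⁺ k (there e∈X) = there (∈-embed⁺ k e∈X)

∈-embed⁻ : ∀ {n} k (X : Subset n) {i} → i ∈ embed k X → ∃ λ e → e ∈ X × i ≡ e ↑ˡ k
∈-embed⁻ k []          i∈ = ⊥-elim (∉⊥ i∈)
∈-embed⁻ k (true ∷ X) here = zero , here , refl
∈-embed⁻ k (_    ∷ X) (there i∈) with ∈-embed⁻ k X i∈
... | e , e∈X , refl = suc e , there e∈X , refl

embed-mono : ∀ {n} k {X Y : Subset n} → X ⊆ Y → embed k X ⊆ embed k Y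
embed-mono k {X} X⊆Y i∈ with ∈-embed⁻ k X i∈
... | e , e∈X , refl = ∈-embed⁺ k (X⊆Y e∈X)

module Rank {m : ℕ} (N : Matroid m) where

  Spans : Subset m → Subset m → Set
  Spans X Y = r N (X ∪ Y) ≤ r N Y

  Spans? : ∀ X Y → Dec (Spans X Y)
  Spans? X Y = r N (X ∪ Y) ≤? r N Y

  r-submod-⊆ : ∀ {X Y U I} → U ⊆ X ∪ Y → I ⊆ X ∩ Y → r N U + r N I ≤ r N X + r N Y
  r-submod-⊆ {X} {Y} U⊆X∪Y I⊆X∩Y =
    ≤-trans (+-mono-≤ (r-mono N _ _ U⊆X∪Y) (r-mono N _ _ I⊆X∩Y)) (r-submod N X Y)

  r-submod-cancel : ∀ {X Y U I T} → U ⊆ X ∪ Y → I ⊆ X ∩ Y →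
                    r N X + r N Y ≤ r N T + r N I → r N U ≤ r N T
  r-submod-cancel {T = T} U⊆ I⊆ bound =
    +-cancelʳ-≤ _ _ (r N T) (≤-trans (r-submod-⊆ U⊆ I⊆) bound)

  ⊆⇒Spans : ∀ {X Y} → X ⊆ Y → Spans X Y
  ⊆⇒Spans X⊆Y = r-mono N _ _ (∪-lub X⊆Y id)

  Spans-⊆ˡ : ∀ {X′ X Y} → X′ ⊆ X → Spans X Y → Spans X′ Y
  Spans-⊆ˡ X′⊆X X⊆clY = ≤-trans (r-mono N _ _ (∪-mono X′⊆X id)) X⊆clY

  Spans-⊆ʳ : ∀ {X Y Z} → Spans X Y → Y ⊆ Z → Spans X Z
  Spans-⊆ʳ {X} {Y} {Z} X⊆clY Y⊆Z = r-submod-cancel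
    (∪-mono (p⊆p∪q Y) id) (∩-glb (q⊆p∪q X Y) Y⊆Z)
    (≤-trans (+-monoˡ-≤ (r N Z) X⊆clY) (≤-reflexive (+-comm (r N Y) (r N Z))))

  Spans-trans : ∀ {X Y Z} → Spans X Y → Spans Y Z → Spans X Z
  Spans-trans {X} {Y} {Z} X⊆clY Y⊆clZ = r-submod-cancel
    (∪-mono (p⊆p∪q Y) (q⊆p∪q Y Z)) (∩-glb (q⊆p∪q X Y) (p⊆p∪q Z))
    (≤-trans (+-mono-≤ X⊆clY Y⊆clZ) (≤-reflexive (+-comm (r N Y) (r N Z))))

  Spans-∪ : ∀ {X Y Z} → Spans X Z → Spans Y Z → Spans (X ∪ Y) Z
  Spans-∪ {X} {Y} {Z} X⊆clZ Y⊆clZ = r-submod-cancel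
    (∪-lub (∪-mono (p⊆p∪q Z) (p⊆p∪q Z)) (p⊆p∪q (Y ∪ Z) ∘ q⊆p∪q X Z))
    (∩-glb (q⊆p∪q X Z) (q⊆p∪q Y Z))
    (+-mono-≤ X⊆clZ Y⊆clZ)

  Spans-pointwise : ∀ {X Y} → (∀ {e} → e ∈ X → Spans ⁅ e ⁆ Y) → Spans X Y
  Spans-pointwise {X} {Y} = go X (⊂-wellFounded X)
    where
    go : ∀ X → Acc _⊂_ X → (∀ {e} → e ∈ X → Spans ⁅ e ⁆ Y) → Spans X Y
    go X (acc smaller) each with nonempty? X
    ... | no X-empty = ⊆⇒Spans (λ e∈X → ⊥-elim (X-empty (_ , e∈X)))
    ... | yes (x , x∈X) = Spans-⊆ˡ (p⊆⁅x⁆∪p-x X x)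
          (Spans-∪ (each x∈X)
                   (go (X - x) (smaller (x∈p⇒p-x⊂p x∈X)) (each ∘ p─q⊆p X ⁅ x ⁆)))

  dependent⇒nonempty : ∀ {X} → r N X < ∣ X ∣ → Nonempty X
  dependent⇒nonempty {X} rX<∣X∣ with nonempty? X
  ... | yes X-nonempty = X-nonempty
  ... | no  X-empty    = ⊥-elim (n≮0 (≤-trans rX<∣X∣ ∣X∣≤0))
    where
    ∣X∣≤0 : ∣ X ∣ ≤ 0
    ∣X∣≤0 = ≤-reflexive (trans (cong ∣_∣ (Empty-unique X-empty)) (∣⊥∣≡0 m))

  Independent-⊆ : ∀ {V X} → Independent N V → X ⊆ V → Independent N X
  Independent-⊆ {V} {X} V-indep X⊆V = ≤-antisym (r-bound N X)
    (+-cancelʳ-≤ ∣ Y ∣ _ _ (begin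
      ∣ X ∣ + ∣ Y ∣             ≡⟨ cong (λ Z → ∣ Z ∣ + ∣ Y ∣) V∩X≡X ⟨
      ∣ V ∩ X ∣ + ∣ Y ∣         ≡⟨ ∣p∩q∣+∣p∩∁q∣≡∣p∣ V X ⟩
      ∣ V ∣                     ≡⟨ V-indep ⟨
      r N V                     ≤⟨ m≤m+n (r N V) (r N (X ∩ Y)) ⟩
      r N V + r N (X ∩ Y)       ≤⟨ r-submod-⊆ V⊆X∪Y id ⟩
      r N X + r N Y             ≤⟨ +-monoʳ-≤ (r N X) (r-bound N Y) ⟩
      r N X + ∣ Y ∣             ∎))
    where
    open ≤-Reasoning
    Y = V ∩ ∁ X
    V∩X≡X : V ∩ X ≡ X
    V∩X≡X = ⊆-antisym (p∩q⊆q V X) (∩-glb X⊆V id)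
    V⊆X∪Y : V ⊆ X ∪ Y
    V⊆X∪Y = ⊆-trans (p⊆[p∩q]∪[p∩∁q] V X) (∪-mono (p∩q⊆q V X) id)

  Spans-∩ : ∀ {V A B X} → Independent N V → A ⊆ V → B ⊆ V →
            Spans X A → Spans X B → Spans X (A ∩ B)
  Spans-∩ {V} {A} {B} {X} V-indep A⊆V B⊆V X⊆clA X⊆clB =
    +-cancelˡ-≤ (r N (A ∪ B)) _ _ (begin
      r N (A ∪ B) + r N (X ∪ (A ∩ B))   ≤⟨ r-submod-⊆ A∪B⊆ X∪[A∩B]⊆ ⟩
      r N (X ∪ A) + r N (X ∪ B)         ≤⟨ +-mono-≤ X⊆clA X⊆clB ⟩
      r N A + r N B                     ≤⟨ +-mono-≤ (r-bound N A) (r-bound N B) ⟩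
      ∣ A ∣ + ∣ B ∣                     ≡⟨ ∣p∪q∣+∣p∩q∣≡∣p∣+∣q∣ A B ⟨
      ∣ A ∪ B ∣ + ∣ A ∩ B ∣             ≡⟨ cong₂ _+_ (indep (∪-lub A⊆V B⊆V))
                                                     (indep (A⊆V ∘ p∩q⊆p A B)) ⟨
      r N (A ∪ B) + r N (A ∩ B)         ∎)
    where
    open ≤-Reasoning
    indep : ∀ {Z} → Z ⊆ V → r N Z ≡ ∣ Z ∣
    indep = Independent-⊆ V-indep
    A∪B⊆ : A ∪ B ⊆ (X ∪ A) ∪ (X ∪ B)
    A∪B⊆ = ∪-mono (q⊆p∪q X A) (q⊆p∪q X B)
    X∪[A∩B]⊆ : X ∪ (A ∩ B) ⊆ (X ∪ A) ∩ (X ∪ B)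
    X∪[A∩B]⊆ = ∩-glb (∪-mono id (p∩q⊆p A B)) (∪-mono id (p∩q⊆q A B))

  Spans-parts⇒skew : ∀ {V R A B} → Independent N V →
                     Spans A (V ∩ R) → Spans B (V ∩ ∁ R) → r N A + r N B ≤ r N (A ∪ B)
  Spans-parts⇒skew {V} {R} {A} {B} V-indep A⊆clP B⊆clQ =
    +-cancelʳ-≤ ∣ V ∣ _ _ (begin
      (r N A + r N B) + ∣ V ∣
        ≡⟨ solve 3 (λ a b v → (a :+ b) :+ v := a :+ (v :+ b)) refl (r N A) (r N B) ∣ V ∣ ⟩
      r N A + (∣ V ∣ + r N B)
        ≡⟨ cong (λ z → r N A + (z + r N B)) V-indep ⟨
      r N A + (r N V + r N B)
        ≤⟨ +-monoʳ-≤ (r N A) (r-submod-⊆ V⊆ (∩-glb (p⊆p∪q P) (p⊆p∪q Q))) ⟩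
      r N A + (r N (B ∪ P) + r N (B ∪ Q))
        ≡⟨ solve 3 (λ a x y → a :+ (x :+ y) := (x :+ a) :+ y) refl
                   (r N A) (r N (B ∪ P)) (r N (B ∪ Q)) ⟩
      (r N (B ∪ P) + r N A) + r N (B ∪ Q)
        ≤⟨ +-monoˡ-≤ (r N (B ∪ Q))
             (r-submod-⊆ (∪-mono (q⊆p∪q A B) (q⊆p∪q A P)) (∩-glb (p⊆p∪q B) (p⊆p∪q P))) ⟩
      (r N (A ∪ B) + r N (A ∪ P)) + r N (B ∪ Q)
        ≤⟨ +-mono-≤ (+-monoʳ-≤ (r N (A ∪ B)) (≤-trans A⊆clP (r-bound N P)))
                    (≤-trans B⊆clQ (r-bound N Q)) ⟩
      (r N (A ∪ B) + ∣ P ∣) + ∣ Q ∣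
        ≡⟨ +-assoc (r N (A ∪ B)) ∣ P ∣ ∣ Q ∣ ⟩
      r N (A ∪ B) + (∣ P ∣ + ∣ Q ∣)
        ≡⟨ cong (r N (A ∪ B) +_) (∣p∩q∣+∣p∩∁q∣≡∣p∣ V R) ⟩
      r N (A ∪ B) + ∣ V ∣ ∎)
    where
    open ≤-Reasoning
    open +-*-Solver
    P = V ∩ R
    Q = V ∩ ∁ R
    V⊆ : V ⊆ (B ∪ P) ∪ (B ∪ Q)
    V⊆ = ⊆-trans (p⊆[p∩q]∪[p∩∁q] V R) (∪-mono (q⊆p∪q B P) (q⊆p∪q B Q))

module _ {n : ℕ} (G : Graph n) where

  end₁ end₂ : Fin n → Fin (nv G)
  end₁ e = proj₁ (ends G e)
  end₂ e = proj₂ (ends G e)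

  ∈-edgesIn⁻ : ∀ {K e} → e ∈ edgesIn G K → end₁ e ∈ K × end₂ e ∈ K
  ∈-edgesIn⁻ {K} {e} e∈ = both (trans (sym (lookup∘tabulate _ e)) ([]=⇒lookup e∈))
    where
    both : lookup K (end₁ e) ∧ lookup K (end₂ e) ≡ true → end₁ e ∈ K × end₂ e ∈ K
    both eq with lookup K (end₁ e) in eq₁ | lookup K (end₂ e) in eq₂
    both refl | true | true = lookup⇒[]= _ K eq₁ , lookup⇒[]= _ K eq₂

  ∈-edgesIn⁺ : ∀ {K e} → end₁ e ∈ K → end₂ e ∈ K → e ∈ edgesIn G K
  ∈-edgesIn⁺ {K} {e} s∈K t∈K = lookup⇒[]= e _ (begin
    lookup (edgesIn G K) e                   ≡⟨ lookup∘tabulate _ e ⟩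
    lookup K (end₁ e) ∧ lookup K (end₂ e)    ≡⟨ cong₂ _∧_ ([]=⇒lookup s∈K) ([]=⇒lookup t∈K) ⟩
    true                                     ∎)
    where open ≡-Reasoning

  ∈-edgesAvoiding⁻ : ∀ {v e} → e ∈ edgesAvoiding G v → end₁ e ≢ v × end₂ e ≢ v
  ∈-edgesAvoiding⁻ {v} {e} e∈ =
    neither (end₁ e ≟ᶠ v) (end₂ e ≟ᶠ v) (trans (sym (lookup∘tabulate _ e)) ([]=⇒lookup e∈))
    where
    neither : ∀ {P Q : Set} (p : Dec P) (q : Dec Q) → not (⌊ p ⌋ ∨ ⌊ q ⌋) ≡ true → ¬ P × ¬ Q
    neither (no ¬p) (no ¬q) _ = ¬p , ¬q

  ∈-edgesAvoiding⁺ : ∀ {v e} → end₁ e ≢ v → end₂ e ≢ v → e ∈ edgesAvoiding G v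
  ∈-edgesAvoiding⁺ {v} {e} s≢v t≢v =
    lookup⇒[]= e _ (trans (lookup∘tabulate _ e) (neither (end₁ e ≟ᶠ v) (end₂ e ≟ᶠ v)))
    where
    neither : (p : Dec (end₁ e ≡ v)) (q : Dec (end₂ e ≡ v)) → not (⌊ p ⌋ ∨ ⌊ q ⌋) ≡ true
    neither (yes p) _       = ⊥-elim (s≢v p)
    neither (no _)  (yes q) = ⊥-elim (t≢v q)
    neither (no _)  (no _)  = refl

  ClosedUnder : Subset n → Subset (nv G) → Set
  ClosedUnder X R = ∀ {e} → e ∈ X → (end₁ e ∈ R → end₂ e ∈ R) × (end₂ e ∈ R → end₁ e ∈ R)

  closed⊎leaving : ∀ X R → ClosedUnder X R ⊎ ∃₂ λ u w → u ∈ R × w ∉ R × AdjVia G X u w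
  closed⊎leaving X R with any? (λ e → e ∈? X ×-dec ((end₁ e ∈? R ×-dec ¬? (end₂ e ∈? R))
                                               ⊎-dec (end₂ e ∈? R ×-dec ¬? (end₁ e ∈? R))))
  ... | yes (e , e∈X , inj₁ (s∈R , t∉R)) = inj₂ (_ , _ , s∈R , t∉R , e , e∈X , inj₁ (refl , refl))
  ... | yes (e , e∈X , inj₂ (t∈R , s∉R)) = inj₂ (_ , _ , t∈R , s∉R , e , e∈X , inj₂ (refl , refl))
  ... | no none-leaves = inj₁ λ {e} e∈X →
          (λ s∈R → decidable-stable (end₂ e ∈? R) λ t∉R → none-leaves (e , e∈X , inj₁ (s∈R , t∉R))) ,
          (λ t∈R → decidable-stable (end₁ e ∈? R) λ s∉R → none-leaves (e , e∈X , inj₂ (t∈R , s∉R)))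

  record ClosedRegion (X : Subset n) (a : Fin (nv G)) : Set where
    field
      region      : Subset (nv G)
      root∈region : a ∈ region
      reachable   : ∀ {x} → x ∈ region → ConnVia G X a x
      closed      : ClosedUnder X region

  closedRegion : ∀ X a → ClosedRegion X a
  closedRegion X a = grow ⁅ a ⁆ (⊃-wellFounded ⁅ a ⁆) (x∈⁅x⁆ a) from-root
    where
    from-root : ∀ {x} → x ∈ ⁅ a ⁆ → ConnVia G X a x
    from-root x∈⁅a⁆ rewrite x∈⁅y⁆⇒x≡y a x∈⁅a⁆ = ε
    grow : ∀ R → Acc _⊃_ R → a ∈ R → (∀ {x} → x ∈ R → ConnVia G X a x) → ClosedRegion X a
    grow R (acc larger) a∈R reach with closed⊎leaving X R
    ... | inj₁ closed = record
      { region = R ; root∈region = a∈R ; reachable = reach ; closed = closed }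
    ... | inj₂ (u , w , u∈R , w∉R , u~w) =
      grow (R ∪ ⁅ w ⁆) (larger R⊂R∪w) (p⊆p∪q ⁅ w ⁆ a∈R) reach′
      where
      R⊂R∪w : R ⊂ R ∪ ⁅ w ⁆
      R⊂R∪w = p⊆p∪q ⁅ w ⁆ , w , q⊆p∪q R ⁅ w ⁆ (x∈⁅x⁆ w) , w∉R
      reach′ : ∀ {x} → x ∈ R ∪ ⁅ w ⁆ → ConnVia G X a x
      reach′ x∈ with x∈p∪q⁻ R ⁅ w ⁆ x∈
      ... | inj₁ x∈R = reach x∈R
      ... | inj₂ x∈⁅w⁆ rewrite x∈⁅y⁆⇒x≡y w x∈⁅w⁆ = reach u∈R ◅◅ (u~w ◅ ε)

module FrameGraph {n k : ℕ} (M : Matroid n) (M′ : Matroid (n + k))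
  (V-indep : Independent M′ (frameSet n k))
  (spanned : ∀ e → ∃ λ S → S ⊆ frameSet n k × ∣ S ∣ ≤ 2 × InClosure M′ e S)
  (r-embed : ∀ X → r M X ≡ r M′ (embed k X)) where

  open Rank M′

  V : Subset (n + k)
  V = frameSet n k

  ι : Fin n → Fin (n + k)
  ι e = e ↑ˡ k

  Essential : Fin n → Fin (n + k) → Set
  Essential e f = ¬ Spans ⁅ ι e ⁆ (V ∩ ∁ ⁅ f ⁆)

  record Placement (e : Fin n) : Set where
    field
      src tgt        : Fin (n + k)
      support        : Subset (n + k)
      support⊆V      : support ⊆ V
      support⊆ends   : support ⊆ ⁅ src ⁆ ∪ ⁅ tgt ⁆
      spans          : Spans ⁅ ι e ⁆ support
      ends-essential : src ≢ tgt → Essential e src × Essential e tgt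

  loopAt : ∀ {e S} x y → S ⊆ V → S ⊆ ⁅ x ⁆ ∪ ⁅ y ⁆ → Spans ⁅ ι e ⁆ S →
           Spans ⁅ ι e ⁆ (V ∩ ∁ ⁅ x ⁆) → Placement e
  loopAt {S = S} x y S⊆V S⊆xy e∈clS e∈clV-x = record
    { src = y ; tgt = y
    ; support        = S ∩ (V ∩ ∁ ⁅ x ⁆)
    ; support⊆V      = S⊆V ∘ p∩q⊆p S _
    ; support⊆ends   = p⊆p∪q ⁅ y ⁆ ∘ in-y
    ; spans          = Spans-∩ V-indep S⊆V (p∩q⊆p V _) e∈clS e∈clV-x
    ; ends-essential = λ y≢y → ⊥-elim (y≢y refl)
    }
    where
    in-y : S ∩ (V ∩ ∁ ⁅ x ⁆) ⊆ ⁅ y ⁆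
    in-y i∈ with x∈p∩q⁻ S _ i∈
    ... | i∈S , i∈V-x = [ (λ i∈⁅x⁆ → ⊥-elim (x∈∁p⇒x∉p (proj₂ (x∈p∩q⁻ V _ i∈V-x)) i∈⁅x⁆)) , id ]
                          (x∈p∪q⁻ _ _ (S⊆xy i∈S))

  placement : ∀ e → Placement e
  placement e with spanned (ι e)
  ... | S , S⊆V , ∣S∣≤2 , e∈clS with ∣p∣≤2⇒p⊆⁅x⁆∪⁅y⁆ S (ι e) ∣S∣≤2
  ... | x , y , S⊆xy with Spans? ⁅ ι e ⁆ (V ∩ ∁ ⁅ x ⁆) | Spans? ⁅ ι e ⁆ (V ∩ ∁ ⁅ y ⁆)
  ... | yes e∈clV-x | _ = loopAt x y S⊆V S⊆xy (≤-reflexive e∈clS) e∈clV-x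
  ... | no _ | yes e∈clV-y =
    loopAt y x S⊆V (⊆-trans S⊆xy (⊆-reflexive (∪-comm ⁅ x ⁆ ⁅ y ⁆))) (≤-reflexive e∈clS) e∈clV-y
  ... | no x-essential | no y-essential = record
    { src = x ; tgt = y ; support = S ; support⊆V = S⊆V ; support⊆ends = S⊆xy
    ; spans = ≤-reflexive e∈clS ; ends-essential = λ _ → x-essential , y-essential }

  framedGraph : Graph n
  framedGraph = record
    { nv = n + k ; ends = λ e → Placement.src (placement e) , Placement.tgt (placement e) }

  private
    G = framedGraph

  Spans-edges : ∀ {X P} → (∀ {e} → e ∈ X → end₁ G e ∈ P × end₂ G e ∈ P) →
                Spans (embed k X) (V ∩ P)
  Spans-edges {X} {P} ends∈P = Spans-pointwise spans-each
    where
    support⊆V∩P : ∀ {e} → e ∈ X → Placement.support (placement e) ⊆ V ∩ P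
    support⊆V∩P e∈X i∈ with ends∈P e∈X | x∈p∪q⁻ _ _ (Placement.support⊆ends (placement _) i∈)
    ... | s∈P , _ | inj₁ i∈⁅s⁆ rewrite x∈⁅y⁆⇒x≡y _ i∈⁅s⁆ =
      x∈p∩q⁺ (Placement.support⊆V (placement _) i∈ , s∈P)
    ... | _ , t∈P | inj₂ i∈⁅t⁆ rewrite x∈⁅y⁆⇒x≡y _ i∈⁅t⁆ =
      x∈p∩q⁺ (Placement.support⊆V (placement _) i∈ , t∈P)
    spans-each : ∀ {i} → i ∈ embed k X → Spans ⁅ i ⁆ (V ∩ P)
    spans-each i∈ with ∈-embed⁻ k X i∈
    ... | e , e∈X , refl = Spans-⊆ʳ (Placement.spans (placement e)) (support⊆V∩P e∈X)

  edgesIn-rank : ∀ K → r M (edgesIn G K) ≤ ∣ K ∣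
  edgesIn-rank K = begin
    r M X                         ≡⟨ r-embed X ⟩
    r M′ (embed k X)              ≤⟨ r-mono M′ _ _ (p⊆p∪q (V ∩ K)) ⟩
    r M′ (embed k X ∪ (V ∩ K))    ≤⟨ Spans-edges (∈-edgesIn⁻ G) ⟩
    r M′ (V ∩ K)                  ≤⟨ r-bound M′ (V ∩ K) ⟩
    ∣ V ∩ K ∣                     ≤⟨ ∣p∩q∣≤∣q∣ V K ⟩
    ∣ K ∣                         ∎
    where
    open ≤-Reasoning
    X = edgesIn G K

  InClosure⇒Spans : ∀ {e X} → InClosure M e X → Spans ⁅ ι e ⁆ (embed k X)
  InClosure⇒Spans {e} {X} e∈clX = begin
    r M′ (⁅ ι e ⁆ ∪ embed k X)    ≤⟨ r-mono M′ _ _ (∪-lub ⁅ιe⁆⊆ (embed-mono k (q⊆p∪q ⁅ e ⁆ X))) ⟩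
    r M′ (embed k (⁅ e ⁆ ∪ X))    ≡⟨ r-embed _ ⟨
    r M (⁅ e ⁆ ∪ X)               ≡⟨ e∈clX ⟩
    r M X                         ≡⟨ r-embed X ⟩
    r M′ (embed k X)              ∎
    where
    open ≤-Reasoning
    ⁅ιe⁆⊆ : ⁅ ι e ⁆ ⊆ embed k (⁅ e ⁆ ∪ X)
    ⁅ιe⁆⊆ i∈ rewrite x∈⁅y⁆⇒x≡y _ i∈ = ∈-embed⁺ k (p⊆p∪q X (x∈⁅x⁆ e))

  InClosure-avoiding⇒Spans : ∀ {v e} → InClosure M e (edgesAvoiding G v) →
                            Spans ⁅ ι e ⁆ (V ∩ ∁ ⁅ v ⁆)
  InClosure-avoiding⇒Spans e∈cl = Spans-trans (InClosure⇒Spans e∈cl) (Spans-edges outside-v)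
    where
    outside-v : ∀ {e} → e ∈ edgesAvoiding G _ → end₁ G e ∈ ∁ ⁅ _ ⁆ × end₂ G e ∈ ∁ ⁅ _ ⁆
    outside-v e∈ with ∈-edgesAvoiding⁻ G e∈
    ... | s≢v , t≢v = x∉p⇒x∈∁p (x≢y⇒x∉⁅y⁆ s≢v) , x∉p⇒x∈∁p (x≢y⇒x∉⁅y⁆ t≢v)

  vertex-closure : ∀ v e → InClosure M e (edgesAvoiding G v) →
                   e ∈ edgesAvoiding G v ⊎ IsLoopAt G e v
  vertex-closure v e e∈cl with end₁ G e ≟ᶠ v | end₂ G e ≟ᶠ v
  ... | no s≢v   | no t≢v   = inj₁ (∈-edgesAvoiding⁺ G s≢v t≢v)
  ... | yes s≡v  | yes t≡v  = inj₂ (s≡v , t≡v)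
  ... | yes refl | no t≢v   =
    ⊥-elim (proj₁ (Placement.ends-essential (placement e) (t≢v ∘ sym)) (InClosure-avoiding⇒Spans e∈cl))
  ... | no s≢v   | yes refl =
    ⊥-elim (proj₂ (Placement.ends-essential (placement e) s≢v) (InClosure-avoiding⇒Spans e∈cl))

  circuit-unsplit : ∀ {C R e f} → Circuit M C → ClosedUnder G C R →
                    e ∈ C → f ∈ C → end₁ G e ∈ R → end₁ G f ∈ R
  circuit-unsplit {C} {R} {e} {f} (C-dependent , C-minimal) closed e∈C f∈C s∈R
    with end₁ G f ∈? R
  ... | yes sf∈R = sf∈R
  ... | no  sf∉R = ⊥-elim (<-irrefl refl (begin-strict
    ∣ C ∣                               ≤⟨ p⊆q⇒∣p∣≤∣q∣ C⊆A∪B ⟩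
    ∣ A ∪ B ∣                           ≤⟨ ∣p∪q∣≤∣p∣+∣q∣ A B ⟩
    ∣ A ∣ + ∣ B ∣                       ≡⟨ cong₂ _+_ (C-minimal A A⊂C) (C-minimal B B⊂C) ⟨
    r M A + r M B                       ≡⟨ cong₂ _+_ (r-embed A) (r-embed B) ⟩
    r M′ (embed k A) + r M′ (embed k B) ≤⟨ Spans-parts⇒skew V-indep A-spanned B-spanned ⟩
    r M′ (embed k A ∪ embed k B)        ≤⟨ r-mono M′ _ _ (∪-lub (embed-mono k (p∩q⊆p C _))
                                                               (embed-mono k (p∩q⊆p C _))) ⟩
    r M′ (embed k C)                    ≡⟨ r-embed C ⟨
    r M C                               <⟨ C-dependent ⟩
    ∣ C ∣                               ∎))
    where
    open ≤-Reasoning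
    A = C ∩ edgesIn G R
    B = C ∩ edgesIn G (∁ R)
    C⊆A∪B : C ⊆ A ∪ B
    C⊆A∪B {g} g∈C with end₁ G g ∈? R
    ... | yes g₁∈R = x∈p∪q⁺ (inj₁ (x∈p∩q⁺ (g∈C , ∈-edgesIn⁺ G g₁∈R (proj₁ (closed g∈C) g₁∈R))))
    ... | no  g₁∉R = x∈p∪q⁺ (inj₂ (x∈p∩q⁺ (g∈C , ∈-edgesIn⁺ G (x∉p⇒x∈∁p g₁∉R)
                              (x∉p⇒x∈∁p (g₁∉R ∘ proj₂ (closed g∈C))))))
    A⊂C : A ⊂ C
    A⊂C = p∩q⊆p C _ , f , f∈C , sf∉R ∘ proj₁ ∘ ∈-edgesIn⁻ G ∘ p∩q⊆q C _
    B⊂C : B ⊂ C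
    B⊂C = p∩q⊆p C _ , e , e∈C , (λ e∈B → x∈∁p⇒x∉p (proj₁ (∈-edgesIn⁻ G (p∩q⊆q C _ e∈B))) s∈R)
    A-spanned : Spans (embed k A) (V ∩ R)
    A-spanned = Spans-edges (∈-edgesIn⁻ G ∘ p∩q⊆q C _)
    B-spanned : Spans (embed k B) (V ∩ ∁ R)
    B-spanned = Spans-edges (∈-edgesIn⁻ G ∘ p∩q⊆q C _)

  circuit-connected : ∀ C → Circuit M C → AtMostTwoComponents G C
  circuit-connected C circuit = a , a , λ e x e∈C x-end → inj₁ (reachable (end∈region e∈C x-end))
    where
    e₀∈C : Nonempty C
    e₀∈C = Rank.dependent⇒nonempty M (proj₁ circuit)
    a = end₁ G (proj₁ e₀∈C)
    open ClosedRegion (closedRegion G C a)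
    end∈region : ∀ {e x} → e ∈ C → IsEnd G x e → x ∈ region
    end∈region e∈C (inj₁ refl) = circuit-unsplit circuit closed (proj₂ e₀∈C) e∈C root∈region
    end∈region e∈C (inj₂ refl) =
      proj₁ (closed e∈C) (circuit-unsplit circuit closed (proj₂ e₀∈C) e∈C root∈region)

  framework : Framework M G
  framework = record
    { comp-rank     = λ K _ → edgesIn-rank K
    ; vertex-cl     = vertex-closure
    ; circuit-comps = circuit-connected
    }

theorem1p3 : {n : ℕ} (M : Matroid n) → FrameMatroid M → QuasiGraphic M
theorem1p3 M (k , M′ , ((V-indep , _) , spanned) , r-embed) =
  FrameGraph.framedGraph M M′ V-indep spanned r-embed ,
  FrameGraph.framework M M′ V-indep spanned r-embed
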